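{- Let $p$ be a prime, $d\in\mathbb{N}$, and $e_1,\dots,e_d\in\mathbb{N}$ with $e_i\le e_{i+1}$ for $1\le i\le d-1$. Let $G=C_{p^{e_1}}\times C_{p^{e_2}}\times\cdots\times C_{p^{e_d}}$ and suppose $p^{e_d}\ge 1+\sum_{i=1}^{d-1}(p^{e_i}-1)$. Then for every $r\in\mathbb{N}$, $$D_r(G)=r\,p^{e_d}+\sum_{i=1}^{d-1}p^{e_i}-d+1.$$
   Context: All groups are finite abelian, written additively; $C_n$ is the cyclic group of order $n$. A sequence over $G$ is a finite multiset of elements of $G$; subsequences are sub-multisets; two subsequences are disjoint if together they form a subsequence (i.e. they use distinct terms). A sequence is zero-sum if the sum of its terms is $0$. For $r\in\mathbb{N}$, the $r$-wise Davenport constant $D_r(G)$ is the least positive integer $k$ such that every sequence over $G$ of length at least $k$ contains $r$ pairwise disjoint nonempty zero-sum subsequences. -}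

module Defs where

open import Data.Nat using (ℕ; zero; suc; _+_; _*_; _∸_; _^_; _≤_; _<_)
open import Data.Nat.Divisibility using (_∣_)
open import Data.Fin using (Fin; zero; suc; toℕ; inject₁; fromℕ)
open import Data.Fin.Properties using (_≟_)
open import Data.List using (List; []; _∷_; length; map; tabulate)
open import Data.Nat.ListAction using (sum)
open import Data.Bool using (Bool; if_then_else_)
open import Data.Product using (Σ; _×_)
open import Relation.Nullary using (¬_)
open import Relation.Nullary.Decidable using (⌊_⌋)
open import Relation.Binary.PropositionalEquality using (_≡_)

-- The group G = C_{p^{e_0}} × ... × C_{p^{e_{d-1}}} (coordinates indexed by Fin d);
-- an element is a tuple of residues, coordinate i in Fin (p ^ e i) = {0,…,p^{e i}-1}.
Elem : (p d : ℕ) → (Fin d → ℕ) → Set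
Elem p d e = (i : Fin d) → Fin (p ^ e i)

-- A sequence over G: a finite list of elements (order irrelevant for all notions below).
Seq : (p d : ℕ) → (Fin d → ℕ) → Set
Seq p d e = List (Elem p d e)

select : {A : Set} (S : List A) → (Fin (length S) → Bool) → List A
select []      f = []
select (x ∷ S) f = if f zero then x ∷ select S (λ t → f (suc t)) else select S (λ t → f (suc t))

IsZeroSum : (p d : ℕ) (e : Fin d → ℕ) → Seq p d e → Set
IsZeroSum p d e T = (i : Fin d) → p ^ e i ∣ sum (map (λ g → toℕ (g i)) T)

-- S contains r pairwise disjoint nonempty zero-sum subsequences:
-- a labelling of the positions of S by {0,…,r}, label 0 = unused,
-- label (suc j) = belongs to the j-th subsequence; each of these r
-- subsequences is nonempty and zero-sum.
HasDisjointZS : (p d : ℕ) (e : Fin d → ℕ) (r : ℕ) → Seq p d e → Set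
HasDisjointZS p d e r S =
  Σ (Fin (length S) → Fin (suc r)) λ ℓ →
    (j : Fin r) →
      let T = select S (λ t → ⌊ ℓ t ≟ suc j ⌋) in
      (¬ T ≡ []) × IsZeroSum p d e T

DavenportProp : (p d : ℕ) (e : Fin d → ℕ) (r k : ℕ) → Set
DavenportProp p d e r k = (S : Seq p d e) → k ≤ length S → HasDisjointZS p d e r S

IsDavenport : (p d : ℕ) (e : Fin d → ℕ) (r k : ℕ) → Set
IsDavenport p d e r k =
  (1 ≤ k) × DavenportProp p d e r k × ((j : ℕ) → 1 ≤ j → j < k → ¬ DavenportProp p d e r j)

{-# OPTIONS --safe #-}
module Submission where

-- Olson's theorem: a sequence over the p-group G = ⊕ᵢ C_{p^{eᵢ}} of length at least
-- D*(G) = 1 + Σᵢ (p^{eᵢ} − 1) has a nonempty zero-sum subsequence. With χ the indicator of the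
-- lattice ⊕ᵢ p^{eᵢ}ℤ in ℕ^d, Φ_S(x) = Σ_{T ⊆ S} (−1)^|T| χ(x + σ(T)) is an |S|-fold difference of χ.
-- A p^e-fold difference of the indicator of p^eℤ vanishes mod p, so by pigeonhole every difference
-- of χ of order ≥ D*(G) does; hence Φ_S(0) ≡ 0 mod p when |S| ≥ D*(G), whereas Φ_S(0) = 1 if S
-- has no nonempty zero-sum subsequence.
--
-- Upper bound: let q = p^{e_d}, so that D*(G) < 2q by hypothesis. Read in C_q ⊕ G through
-- g ↦ (1, g), a sequence of length ≥ D*(G) + q − 1 has by Olson a nonempty zero-sum subsequence
-- of length q or 2q, and one of length 2q splits by Olson in G into two zero-sum parts, one of
-- length ≤ q. Removing such short subsequences one at a time gives D_r(G) ≤ D*(G) + (r − 1) q.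
--
-- Lower bound: p^{eᵢ} − 1 copies of each unit vector eᵢ (i < d) and r q − 1 copies of e_d contain
-- no r disjoint nonempty zero-sum subsequences, since each would need q copies of e_d.

open import Defs
open import Data.Bool using (Bool; true; false; if_then_else_; not)
open import Data.Empty using (⊥-elim)
open import Data.Fin using (Fin; zero; suc; toℕ; inject₁; fromℕ; fromℕ<; punchIn; cast)
open import Data.Fin using () renaming (suc to fsuc)
open import Data.Fin.Properties using (_≟_; any?; all?; toℕ-fromℕ<; fromℕ≢inject₁)
open import Data.Integer as ℤ using (ℤ; 0ℤ; 1ℤ; -1ℤ)
import Data.Integer.Properties as ℤ
open import Data.Integer.Divisibility.Signed as ℤ using () renaming (_∣_ to _∣ᶻ_)
open import Data.Integer.Tactic.RingSolver using (solve-∀)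
open import Data.List using (List; []; _∷_; length; map; tabulate; replicate; _++_; take)
open import Data.List.Properties using (tabulate-cong; map-++; length-take; length-map)
open import Data.Nat
  using (ℕ; zero; suc; pred; _+_; _*_; _∸_; _^_; _≤_; _<_; z≤n; s≤s; _≤?_;
         NonZero; >-nonZero; >-nonZero⁻¹; nonTrivial⇒≢1)
open import Data.Nat.Combinatorics using (_C_; nC1≡n; nCn≡1; nCk+nC[k+1]≡[n+1]C[k+1]; k>n⇒nCk≡0)
open import Data.Nat.Divisibility
  using (_∣_; divides; _∣?_; ∣-refl; ∣-trans; m∣m*n; *-cancelˡ-∣; ∣1⇒≡1; ∣⇒≤; ∣m∣n⇒∣m+n; ∣m+n∣m⇒∣n)
open import Data.Nat.DivMod using (_%_; m%n<n)
open import Data.Nat.ListAction using (sum)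
open import Data.Nat.ListAction.Properties using (sum-++)
open import Data.Nat.Primality
  using (Prime; euclidsLemma; prime⇒nonZero; prime⇒nonTrivial; prime⇒irreducible; prime[2])
open import Data.Nat.Properties hiding (_≟_)
open import Algebra.Properties.CommutativeSemigroup +-commutativeSemigroup using (interchange; x∙yz≈y∙xz)
open import Data.Product using (Σ; _×_; _,_; proj₁; proj₂)
open import Data.Sum using (_⊎_; inj₁; inj₂; [_,_]′)
open import Data.Vec as Vec using (Vec; lookup; updateAt)
open import Data.Vec.Functional using () renaming (_∷_ to _∷ᶠ_)
open import Data.Vec.Properties
  using (updateAt-commutes; updateAt-updateAt; lookup∘updateAt; lookup∘updateAt′; lookup-replicate)
open import Function using (_∘_; id)
open import Relation.Binary.PropositionalEquality
  using (_≡_; _≢_; refl; sym; trans; cong; cong₂; subst; module ≡-Reasoning)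
open import Relation.Nullary using (¬_; yes; no; does; Dec)
open import Relation.Nullary.Decidable using (⌊_⌋; isYes≗does; dec-true; dec-false)

sum-tabulate-mono-≤ : ∀ {n} {f g : Fin n → ℕ} → (∀ i → f i ≤ g i) →
                      sum (tabulate f) ≤ sum (tabulate g)
sum-tabulate-mono-≤ {zero}  f≤g = z≤n
sum-tabulate-mono-≤ {suc _} f≤g = +-mono-≤ (f≤g zero) (sum-tabulate-mono-≤ (f≤g ∘ suc))

sum-tabulate-+ : ∀ {n} (f g : Fin n → ℕ) →
                 sum (tabulate (λ i → f i + g i)) ≡ sum (tabulate f) + sum (tabulate g)
sum-tabulate-+ {zero}  f g = refl
sum-tabulate-+ {suc _} f g = trans (cong (f zero + g zero +_) (sum-tabulate-+ (f ∘ suc) (g ∘ suc)))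
                                   (interchange (f zero) (g zero) _ _)

sum-tabulate-const : ∀ n c → sum (tabulate {n = n} (λ _ → c)) ≡ n * c
sum-tabulate-const zero    c = refl
sum-tabulate-const (suc n) c = cong (c +_) (sum-tabulate-const n c)

sum-tabulate-zero : ∀ n → sum (tabulate {n = n} (λ _ → 0)) ≡ 0
sum-tabulate-zero n = trans (sum-tabulate-const n 0) (*-zeroʳ n)

sum-tabulate-indicator : ∀ {n} (k : Fin n) c → sum (tabulate (λ j → if does (k ≟ j) then c else 0)) ≡ c
sum-tabulate-indicator {suc n} zero    c = trans (cong (c +_) (sum-tabulate-zero n)) (+-identityʳ c)
sum-tabulate-indicator {suc n} (suc k) c = sum-tabulate-indicator k c

sum-tabulate-init-last : ∀ {n} (f : Fin (suc n) → ℕ) →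
                         sum (tabulate f) ≡ sum (tabulate (f ∘ inject₁)) + f (fromℕ n)
sum-tabulate-init-last {zero}  f = +-comm (f zero) 0
sum-tabulate-init-last {suc n} f = trans (cong (f zero +_) (sum-tabulate-init-last (f ∘ suc)))
                                         (sym (+-assoc (f zero) _ _))

sum-tabulate-∸1 : ∀ {n} (f : Fin n → ℕ) → (∀ i → 1 ≤ f i) →
                  sum (tabulate f) ≡ sum (tabulate (λ i → f i ∸ 1)) + n
sum-tabulate-∸1 {zero}  f f≥1 = refl
sum-tabulate-∸1 {suc n} f f≥1 = begin
  f zero + sum (tabulate (f ∘ suc))
    ≡⟨ cong₂ _+_ (sym (m∸n+n≡m (f≥1 zero))) (sum-tabulate-∸1 (f ∘ suc) (f≥1 ∘ suc)) ⟩
  (f zero ∸ 1 + 1) + (sum (tabulate (λ i → f (suc i) ∸ 1)) + n)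
    ≡⟨ interchange (f zero ∸ 1) 1 _ n ⟩
  f zero ∸ 1 + sum (tabulate (λ i → f (suc i) ∸ 1)) + suc n ∎
  where open ≡-Reasoning

-- Subsequences and disjoint blocks

module _ {A : Set} where

  Selects : (List A → Set) → List A → Set
  Selects P xs = Σ (Fin (length xs) → Bool) λ b → P (select xs b)

  select-none : ∀ (xs : List A) → select xs (λ _ → false) ≡ []
  select-none []       = refl
  select-none (x ∷ xs) = select-none xs

  length-select-split : ∀ (xs : List A) (b : Fin (length xs) → Bool) →
                        length (select xs b) + length (select xs (not ∘ b)) ≡ length xs
  length-select-split []       b = refl
  length-select-split (x ∷ xs) b with b zero
  ... | true  = cong suc (length-select-split xs (b ∘ suc))
  ... | false = trans (+-suc _ _) (cong suc (length-select-split xs (b ∘ suc)))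

  length-select-≤ : ∀ (xs : List A) (b : Fin (length xs) → Bool) → length (select xs b) ≤ length xs
  length-select-≤ xs b = subst (length (select xs b) ≤_) (length-select-split xs b) (m≤m+n _ _)

  sum-select-split : ∀ (w : A → ℕ) (xs : List A) (b : Fin (length xs) → Bool) →
                     sum (map w xs) ≡ sum (map w (select xs b)) + sum (map w (select xs (not ∘ b)))
  sum-select-split w []       b = refl
  sum-select-split w (x ∷ xs) b with b zero
  ... | true  = trans (cong (w x +_) (sum-select-split w xs (b ∘ suc))) (sym (+-assoc (w x) _ _))
  ... | false = trans (cong (w x +_) (sum-select-split w xs (b ∘ suc)))
                      (x∙yz≈y∙xz (w x) (sum (map w (select xs (b ∘ suc)))) _)

  sum-select-≤ : ∀ (w : A → ℕ) (xs : List A) (b : Fin (length xs) → Bool) →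
                 sum (map w (select xs b)) ≤ sum (map w xs)
  sum-select-≤ w xs b = subst (sum (map w (select xs b)) ≤_) (sym (sum-select-split w xs b)) (m≤m+n _ _)

  select-select : ∀ (xs : List A) (b : Fin (length xs) → Bool) (c : Fin (length (select xs b)) → Bool) →
                  Σ (Fin (length xs) → Bool) λ b′ → select xs b′ ≡ select (select xs b) c
  select-select []       b c = b , refl
  select-select (x ∷ xs) b c with b zero
  ... | true  with select-select xs (b ∘ suc) (c ∘ suc)
  ...   | b′ , eq = c zero ∷ᶠ b′ , cong (λ ys → if c zero then x ∷ ys else ys) eq
  select-select (x ∷ xs) b c | false with select-select xs (b ∘ suc) c
  ...   | b′ , eq = false ∷ᶠ b′ , eq

  select-take : ∀ m (xs : List A) (c : Fin (length (take m xs)) → Bool) →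
                Σ (Fin (length xs) → Bool) λ b → select xs b ≡ select (take m xs) c
  select-take zero    xs       c = (λ _ → false) , select-none xs
  select-take (suc m) []       c = c , refl
  select-take (suc m) (x ∷ xs) c with select-take m xs (c ∘ suc)
  ... | b , eq = c zero ∷ᶠ b , cong (λ ys → if c zero then x ∷ ys else ys) eq

  Selects-join : ∀ {P : List A → Set} (xs : List A) → Selects (Selects P) xs → Selects P xs
  Selects-join {P} xs (b , c , Pc) with select-select xs b c
  ... | b′ , eq = b′ , subst P (sym eq) Pc

  Selects-take : ∀ {P : List A → Set} m (xs : List A) → Selects P (take m xs) → Selects P xs
  Selects-take {P} m xs (c , Pc) with select-take m xs c
  ... | b , eq = b , subst P (sym eq) Pc

sum-map-1 : ∀ {A : Set} (xs : List A) → sum (map (λ _ → 1) xs) ≡ length xs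
sum-map-1 []       = refl
sum-map-1 (_ ∷ xs) = cong suc (sum-map-1 xs)

select-map : ∀ {A B : Set} (f : A → B) (xs : List A) .(eq : length xs ≡ length (map f xs))
             (b : Fin (length (map f xs)) → Bool) → select (map f xs) b ≡ map f (select xs (b ∘ cast eq))
select-map f []       eq b = refl
select-map f (x ∷ xs) eq b with b zero
... | true  = cong (f x ∷_) (select-map f xs (cong pred eq) (b ∘ suc))
... | false = select-map f xs (cong pred eq) (b ∘ suc)

⌊suc≟suc⌋ : ∀ {n} (i j : Fin n) → ⌊ suc i ≟ suc j ⌋ ≡ ⌊ i ≟ j ⌋
⌊suc≟suc⌋ i j = trans (isYes≗does (suc i ≟ suc j)) (sym (isYes≗does (i ≟ j)))

sum-tabulate-label-≤ : ∀ {r} (l : Fin (suc r)) c →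
                       sum (tabulate (λ (j : Fin r) → if ⌊ l ≟ suc j ⌋ then c else 0)) ≤ c
sum-tabulate-label-≤ {r} zero    c = ≤-trans (≤-reflexive (sum-tabulate-zero r)) z≤n
sum-tabulate-label-≤     (suc k) c = ≤-reflexive (begin
  sum (tabulate (λ j → if ⌊ suc k ≟ suc j ⌋ then c else 0))
    ≡⟨ cong sum (tabulate-cong (λ j → cong (if_then c else 0) (isYes≗does (suc k ≟ suc j)))) ⟩
  sum (tabulate (λ j → if does (k ≟ j) then c else 0))
    ≡⟨ sum-tabulate-indicator k c ⟩
  c ∎)
  where open ≡-Reasoning

module _ {A : Set} where

  block : (xs : List A) {r : ℕ} → (Fin (length xs) → Fin (suc r)) → Fin r → List A
  block xs ℓ j = select xs (λ t → ⌊ ℓ t ≟ suc j ⌋)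

  HasDisjoint : (List A → Set) → ℕ → List A → Set
  HasDisjoint Q r xs = Σ (Fin (length xs) → Fin (suc r)) λ ℓ → ∀ j → Q (block xs ℓ j)

  sum-map-if : ∀ (w : A → ℕ) (b : Bool) x (ys : List A) →
               sum (map w (if b then x ∷ ys else ys)) ≡ (if b then w x else 0) + sum (map w ys)
  sum-map-if w true  x ys = refl
  sum-map-if w false x ys = refl

  sum-blocks-≤ : ∀ (w : A → ℕ) (xs : List A) {r} (ℓ : Fin (length xs) → Fin (suc r)) →
                 sum (tabulate (λ j → sum (map w (block xs ℓ j)))) ≤ sum (map w xs)
  sum-blocks-≤ w []       {r} ℓ = ≤-reflexive (sum-tabulate-zero r)
  sum-blocks-≤ w (x ∷ xs) {r} ℓ = begin
    sum (tabulate (λ j → sum (map w (block (x ∷ xs) ℓ j))))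
      ≡⟨ cong sum (tabulate-cong (λ j → sum-map-if w ⌊ ℓ zero ≟ suc j ⌋ x (block xs (ℓ ∘ suc) j))) ⟩
    sum (tabulate (λ j → here j + sum (map w (block xs (ℓ ∘ suc) j))))
      ≡⟨ sum-tabulate-+ here (λ j → sum (map w (block xs (ℓ ∘ suc) j))) ⟩
    sum (tabulate here) + sum (tabulate (λ j → sum (map w (block xs (ℓ ∘ suc) j))))
      ≤⟨ +-mono-≤ (sum-tabulate-label-≤ (ℓ zero) (w x)) (sum-blocks-≤ w xs (ℓ ∘ suc)) ⟩
    w x + sum (map w xs) ∎
    where
      open ≤-Reasoning
      here : Fin r → ℕ
      here j = if ⌊ ℓ zero ≟ suc j ⌋ then w x else 0

  module _ {r : ℕ} where

    merge : (xs : List A) (b : Fin (length xs) → Bool) →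
            (Fin (length (select xs (not ∘ b))) → Fin (suc r)) → Fin (length xs) → Fin (suc (suc r))
    merge (x ∷ xs) b ℓ zero    with b zero
    ... | true  = suc zero
    ... | false = punchIn (suc zero) (ℓ zero)
    merge (x ∷ xs) b ℓ (suc t) with b zero
    ... | true  = merge xs (b ∘ suc) ℓ t
    ... | false = merge xs (b ∘ suc) (ℓ ∘ suc) t

    select-merge-new : ∀ (xs : List A) b ℓ (P : Fin (suc (suc r)) → Bool) →
                       P (suc zero) ≡ true → (∀ y → P (punchIn (suc zero) y) ≡ false) →
                       select xs (P ∘ merge xs b ℓ) ≡ select xs b
    select-merge-new []       b ℓ P P-new P-old = refl
    select-merge-new (x ∷ xs) b ℓ P P-new P-old with b zero
    ... | true  rewrite P-new          = cong (x ∷_) (select-merge-new xs (b ∘ suc) ℓ P P-new P-old)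
    ... | false rewrite P-old (ℓ zero) = select-merge-new xs (b ∘ suc) (ℓ ∘ suc) P P-new P-old

    select-merge-old : ∀ (xs : List A) b ℓ (P : Fin (suc (suc r)) → Bool) (Q : Fin (suc r) → Bool) →
                       P (suc zero) ≡ false → (∀ y → P (punchIn (suc zero) y) ≡ Q y) →
                       select xs (P ∘ merge xs b ℓ) ≡ select (select xs (not ∘ b)) (Q ∘ ℓ)
    select-merge-old []       b ℓ P Q P-new P-old = refl
    select-merge-old (x ∷ xs) b ℓ P Q P-new P-old with b zero
    ... | true  rewrite P-new          = select-merge-old xs (b ∘ suc) ℓ P Q P-new P-old
    ... | false rewrite P-old (ℓ zero) = cong (λ ys → if Q (ℓ zero) then x ∷ ys else ys)
                                              (select-merge-old xs (b ∘ suc) (ℓ ∘ suc) P Q P-new P-old)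

  HasDisjoint-zero : ∀ {Q : List A → Set} xs → HasDisjoint Q 0 xs
  HasDisjoint-zero xs = (λ _ → zero) , λ ()

  HasDisjoint-suc : ∀ {Q : List A → Set} {r} (xs : List A) (b : Fin (length xs) → Bool) →
                    Q (select xs b) → HasDisjoint Q r (select xs (not ∘ b)) → HasDisjoint Q (suc r) xs
  HasDisjoint-suc {Q} xs b Q-new (ℓ , Q-old) = merge xs b ℓ , Q-block
    where
      new≢old : ∀ y → ⌊ punchIn (suc zero) y ≟ suc zero ⌋ ≡ false
      new≢old zero    = refl
      new≢old (suc y) = refl

      old-label : ∀ j y → ⌊ punchIn (suc zero) y ≟ suc (suc j) ⌋ ≡ ⌊ y ≟ suc j ⌋
      old-label j zero    = refl
      old-label j (suc y) = ⌊suc≟suc⌋ (suc y) (suc j)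

      Q-block : ∀ j → Q (block xs (merge xs b ℓ) j)
      Q-block zero    = subst Q (sym (select-merge-new xs b ℓ (λ y → ⌊ y ≟ suc zero ⌋) refl new≢old)) Q-new
      Q-block (suc j) = subst Q (sym (select-merge-old xs b ℓ (λ y → ⌊ y ≟ suc (suc j) ⌋) (λ y → ⌊ y ≟ suc j ⌋)
                                                        refl (old-label j)))
                                (Q-old j)

HasDisjoint-map : ∀ {A B : Set} (f : A → B) {Q : List B → Set} {r} (xs : List A) →
                  HasDisjoint Q r (map f xs) → HasDisjoint (Q ∘ map f) r xs
HasDisjoint-map f {Q} xs (ℓ , Qℓ) =
  ℓ ∘ cast eq , λ j → subst Q (select-map f xs eq (λ t → ⌊ ℓ t ≟ suc j ⌋)) (Qℓ j)
  where
    eq : length xs ≡ length (map f xs)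
    eq = sym (length-map f xs)

-- Finite differences and binomial coefficients modulo p

Δ : (ℕ → ℤ) → ℕ → ℤ
Δ ψ t = ψ t ℤ.- ψ (suc t)

Δ^ : ℕ → (ℕ → ℤ) → ℕ → ℤ
Δ^ zero    ψ = ψ
Δ^ (suc c) ψ = Δ^ c (Δ ψ)

Δ^-suc : ∀ c ψ t → Δ^ (suc c) ψ t ≡ Δ (Δ^ c ψ) t
Δ^-suc zero    ψ t = refl
Δ^-suc (suc c) ψ t = Δ^-suc c (Δ ψ) t

indicator : {P : Set} → Dec P → ℤ
indicator P? = if does P? then 1ℤ else 0ℤ

indicator-yes : {P : Set} (P? : Dec P) → P → indicator P? ≡ 1ℤ
indicator-yes P? p = cong (if_then 1ℤ else 0ℤ) (dec-true P? p)

indicator-no : {P : Set} (P? : Dec P) → ¬ P → indicator P? ≡ 0ℤ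
indicator-no P? ¬p = cong (if_then 1ℤ else 0ℤ) (dec-false P? ¬p)

𝟙[_∣_] : ℕ → ℕ → ℤ
𝟙[ q ∣ t ] = indicator (q ∣? t)

next-multiple-wrap : ∀ q₀ t → suc q₀ ∣ t + 0 → suc q₀ ∣ suc t + q₀
next-multiple-wrap q₀ t q∣t+0 =
  subst (suc q₀ ∣_) (+-suc t q₀) (∣m∣n⇒∣m+n (subst (suc q₀ ∣_) (+-identityʳ t) q∣t+0) ∣-refl)

next-multiple : ∀ q₀ t → Σ ℕ λ k → k < suc q₀ × suc q₀ ∣ t + k
next-multiple q₀ zero    = 0 , s≤s z≤n , divides 0 refl
next-multiple q₀ (suc t) with next-multiple q₀ t
... | suc k , k<q , q∣t+k = k , <-trans (n<1+n k) k<q , subst (suc q₀ ∣_) (+-suc t k) q∣t+k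
... | zero  , _   , q∣t+0 = q₀ , n<1+n q₀ , next-multiple-wrap q₀ t q∣t+0

Δ^-sign-step : ∀ c ψ t k → Δ^ c ψ t ≡ -1ℤ ℤ.^ suc k ℤ.* ℤ.+ (c C suc k) →
               Δ^ c ψ (suc t) ≡ -1ℤ ℤ.^ k ℤ.* ℤ.+ (c C k) →
               Δ^ (suc c) ψ t ≡ -1ℤ ℤ.^ suc k ℤ.* ℤ.+ (suc c C suc k)
Δ^-sign-step c ψ t k at-t at-1+t = begin
  Δ^ (suc c) ψ t
    ≡⟨ Δ^-suc c ψ t ⟩
  Δ^ c ψ t ℤ.- Δ^ c ψ (suc t)
    ≡⟨ cong₂ ℤ._-_ at-t at-1+t ⟩
  -1ℤ ℤ.* s ℤ.* ℤ.+ (c C suc k) ℤ.- s ℤ.* ℤ.+ (c C k)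
    ≡⟨ signs s (ℤ.+ (c C suc k)) (ℤ.+ (c C k)) ⟩
  -1ℤ ℤ.* s ℤ.* (ℤ.+ (c C k) ℤ.+ ℤ.+ (c C suc k))
    ≡⟨ cong (-1ℤ ℤ.* s ℤ.*_) (ℤ.pos-+ (c C k) _) ⟨
  -1ℤ ℤ.* s ℤ.* ℤ.+ (c C k + c C suc k)
    ≡⟨ cong (λ m → -1ℤ ℤ.* s ℤ.* ℤ.+ m) (nCk+nC[k+1]≡[n+1]C[k+1] c k) ⟩
  -1ℤ ℤ.* s ℤ.* ℤ.+ (suc c C suc k) ∎
  where
    open ≡-Reasoning
    s = -1ℤ ℤ.^ k
    signs : ∀ s a b → -1ℤ ℤ.* s ℤ.* a ℤ.- s ℤ.* b ≡ -1ℤ ℤ.* s ℤ.* (b ℤ.+ a)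
    signs = solve-∀

Δ^-𝟙 : ∀ q₀ {c} → c < suc q₀ → ∀ t {k} → k < suc q₀ → suc q₀ ∣ t + k →
       Δ^ c 𝟙[ suc q₀ ∣_] t ≡ -1ℤ ℤ.^ k ℤ.* ℤ.+ (c C k)
Δ^-𝟙 q₀ {zero}  _   t {zero}  _   q∣t+0 =
  indicator-yes (suc q₀ ∣? t) (subst (suc q₀ ∣_) (+-identityʳ t) q∣t+0)
Δ^-𝟙 q₀ {zero}  _   t {suc k} k<q q∣t+k =
  trans (indicator-no (suc q₀ ∣? t) (λ q∣t → <⇒≱ k<q (∣⇒≤ (∣m+n∣m⇒∣n q∣t+k q∣t))))
        (sym (ℤ.*-zeroʳ (-1ℤ ℤ.^ suc k)))
Δ^-𝟙 q₀ {suc c} c<q t {suc k} k<q q∣t+k =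
  Δ^-sign-step c 𝟙[ suc q₀ ∣_] t k
    (Δ^-𝟙 q₀ (<-trans (n<1+n c) c<q) t k<q q∣t+k)
    (Δ^-𝟙 q₀ (<-trans (n<1+n c) c<q) (suc t) (<-trans (n<1+n k) k<q)
          (subst (suc q₀ ∣_) (+-suc t k) q∣t+k))
Δ^-𝟙 q₀ {suc c} c<q t {zero}  k<q q∣t+0 = begin
  Δ^ (suc c) 𝟙[ suc q₀ ∣_] t
    ≡⟨ Δ^-suc c 𝟙[ suc q₀ ∣_] t ⟩
  Δ^ c 𝟙[ suc q₀ ∣_] t ℤ.- Δ^ c 𝟙[ suc q₀ ∣_] (suc t)
    ≡⟨ cong₂ ℤ._-_ (Δ^-𝟙 q₀ c<q′ t k<q q∣t+0) (Δ^-𝟙 q₀ c<q′ (suc t) (n<1+n q₀) (next-multiple-wrap q₀ t q∣t+0)) ⟩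
  1ℤ ℤ.- -1ℤ ℤ.^ q₀ ℤ.* ℤ.+ (c C q₀)
    ≡⟨ cong (λ m → 1ℤ ℤ.- -1ℤ ℤ.^ q₀ ℤ.* ℤ.+ m) (k>n⇒nCk≡0 (≤-pred c<q)) ⟩
  1ℤ ℤ.- -1ℤ ℤ.^ q₀ ℤ.* 0ℤ
    ≡⟨ cong (λ z → 1ℤ ℤ.- z) (ℤ.*-zeroʳ (-1ℤ ℤ.^ q₀)) ⟩
  1ℤ ∎
  where
    open ≡-Reasoning
    c<q′ : c < suc q₀
    c<q′ = <-trans (n<1+n c) c<q

-- Δ^q 𝟙[ q ∣_] t is ± (q C k) for some 0 < k < q, or 1 − (−1)^(q−1).
Δ^q-𝟙-∣ : ∀ {m} q₀ → (∀ {k} → 0 < k → k < suc q₀ → m ∣ suc q₀ C k) →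
          ℤ.+ m ∣ᶻ 1ℤ ℤ.- -1ℤ ℤ.^ q₀ → ∀ t → ℤ.+ m ∣ᶻ Δ^ (suc q₀) 𝟙[ suc q₀ ∣_] t
Δ^q-𝟙-∣ {m} q₀ m∣C m∣1-[-1]^q₀ t with next-multiple q₀ t
... | suc k , k<q , q∣t+k =
  subst (ℤ.+ m ∣ᶻ_) (sym Δ^q-𝟙≡) (ℤ.∣n⇒∣m*n (-1ℤ ℤ.^ suc k) (ℤ.∣ᵤ⇒∣ (m∣C (s≤s z≤n) k<q)))
  where
    Δ^q-𝟙≡ : Δ^ (suc q₀) 𝟙[ suc q₀ ∣_] t ≡ -1ℤ ℤ.^ suc k ℤ.* ℤ.+ (suc q₀ C suc k)
    Δ^q-𝟙≡ = Δ^-sign-step q₀ 𝟙[ suc q₀ ∣_] t k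
               (Δ^-𝟙 q₀ (n<1+n q₀) t k<q q∣t+k)
               (Δ^-𝟙 q₀ (n<1+n q₀) (suc t) (<-trans (n<1+n k) k<q)
                     (subst (suc q₀ ∣_) (+-suc t k) q∣t+k))
... | zero  , _   , q∣t+0 = subst (ℤ.+ m ∣ᶻ_) (sym Δ^q-𝟙≡) m∣1-[-1]^q₀
  where
    open ≡-Reasoning
    Δ^q-𝟙≡ : Δ^ (suc q₀) 𝟙[ suc q₀ ∣_] t ≡ 1ℤ ℤ.- -1ℤ ℤ.^ q₀
    Δ^q-𝟙≡ = begin
      Δ^ (suc q₀) 𝟙[ suc q₀ ∣_] t
        ≡⟨ Δ^-suc q₀ 𝟙[ suc q₀ ∣_] t ⟩
      Δ^ q₀ 𝟙[ suc q₀ ∣_] t ℤ.- Δ^ q₀ 𝟙[ suc q₀ ∣_] (suc t)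
        ≡⟨ cong₂ ℤ._-_ (Δ^-𝟙 q₀ (n<1+n q₀) t (s≤s z≤n) q∣t+0)
                       (Δ^-𝟙 q₀ (n<1+n q₀) (suc t) (n<1+n q₀) (next-multiple-wrap q₀ t q∣t+0)) ⟩
      1ℤ ℤ.- -1ℤ ℤ.^ q₀ ℤ.* ℤ.+ (q₀ C q₀)
        ≡⟨ cong (λ m → 1ℤ ℤ.- -1ℤ ℤ.^ q₀ ℤ.* ℤ.+ m) (nCn≡1 q₀) ⟩
      1ℤ ℤ.- -1ℤ ℤ.^ q₀ ℤ.* 1ℤ
        ≡⟨ cong (λ z → 1ℤ ℤ.- z) (ℤ.*-identityʳ (-1ℤ ℤ.^ q₀)) ⟩
      1ℤ ℤ.- -1ℤ ℤ.^ q₀ ∎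

absorption : ∀ n k → suc k * (suc n C suc k) ≡ suc n * (n C k)
absorption zero    zero    = refl
absorption zero    (suc k) = *-zeroʳ (suc (suc k))
absorption (suc n) zero    = trans (+-identityʳ _) (trans (nC1≡n (suc (suc n))) (sym (*-identityʳ _)))
absorption (suc n) (suc k) = begin
  suc (suc k) * (suc (suc n) C suc (suc k))
    ≡⟨ cong (suc (suc k) *_) (nCk+nC[k+1]≡[n+1]C[k+1] (suc n) (suc k)) ⟨
  suc (suc k) * (suc n C suc k + suc n C suc (suc k))
    ≡⟨ *-distribˡ-+ (suc (suc k)) (suc n C suc k) _ ⟩
  suc n C suc k + suc k * (suc n C suc k) + suc (suc k) * (suc n C suc (suc k))
    ≡⟨ cong₂ (λ a b → suc n C suc k + a + b) (absorption n k) (absorption n (suc k)) ⟩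
  suc n C suc k + suc n * (n C k) + suc n * (n C suc k)
    ≡⟨ +-assoc (suc n C suc k) _ _ ⟩
  suc n C suc k + (suc n * (n C k) + suc n * (n C suc k))
    ≡⟨ cong (suc n C suc k +_) (*-distribˡ-+ (suc n) (n C k) _) ⟨
  suc n C suc k + suc n * (n C k + n C suc k)
    ≡⟨ cong (λ a → suc n C suc k + suc n * a) (nCk+nC[k+1]≡[n+1]C[k+1] n k) ⟩
  suc (suc n) * (suc n C suc k) ∎
  where open ≡-Reasoning

-1^-parity : ∀ n → (-1ℤ ℤ.^ n ≡ 1ℤ × 2 ∣ n) ⊎ (-1ℤ ℤ.^ n ≡ -1ℤ × 2 ∣ suc n)
-1^-parity zero    = inj₁ (refl , divides 0 refl)
-1^-parity (suc n) with -1^-parity n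
... | inj₁ (even , divides m n≡m*2) =
  inj₂ (cong (-1ℤ ℤ.*_) even , divides (suc m) (cong (λ k → suc (suc k)) n≡m*2))
... | inj₂ (odd , 2∣1+n) = inj₁ (cong (-1ℤ ℤ.*_) odd , 2∣1+n)

module _ {p : ℕ} (p-prime : Prime p) where

  private instance
    p≢0 : NonZero p
    p≢0 = prime⇒nonZero p-prime

  prime-power-∣-* : ∀ e {k c} → p ^ e ∣ k * c → 0 < k → k < p ^ e → p ∣ c
  prime-power-∣-* zero    _ 0<k k<1 = ⊥-elim (<⇒≱ 0<k (≤-pred k<1))
  prime-power-∣-* (suc e) {k} {c} pq∣kc 0<k k<pq
    with euclidsLemma k c p-prime (∣-trans (m∣m*n (p ^ e)) pq∣kc)
  ... | inj₂ p∣c               = p∣c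
  ... | inj₁ (divides k′ refl) = prime-power-∣-* e q∣k′c (0<k′ k′ 0<k) k′<q
    where
      q∣k′c : p ^ e ∣ k′ * c
      q∣k′c = *-cancelˡ-∣ p (subst (p * p ^ e ∣_) k′pc≡pk′c pq∣kc)
        where
          k′pc≡pk′c : k′ * p * c ≡ p * (k′ * c)
          k′pc≡pk′c = trans (cong (_* c) (*-comm k′ p)) (*-assoc p k′ c)
      0<k′ : ∀ k′ → 0 < k′ * p → 0 < k′
      0<k′ (suc _) _ = s≤s z≤n
      k′<q : k′ < p ^ e
      k′<q = *-cancelʳ-< p k′ (p ^ e) (subst (k′ * p <_) (*-comm p (p ^ e)) k<pq)

  prime-power-∣-C : ∀ e {q₀ k} → p ^ e ≡ suc q₀ → 0 < k → k < suc q₀ → p ∣ suc q₀ C k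
  prime-power-∣-C e {q₀} {suc k} q≡1+q₀ 0<k k<q =
    prime-power-∣-* e (subst (λ q → q ∣ suc k * (suc q₀ C suc k)) (sym q≡1+q₀) q∣k*C) 0<k
                      (subst (suc k <_) (sym q≡1+q₀) k<q)
    where
      q∣k*C : suc q₀ ∣ suc k * (suc q₀ C suc k)
      q∣k*C = divides (q₀ C k) (trans (absorption q₀ k) (*-comm (suc q₀) _))

  2∣p^e⇒p≡2 : ∀ e → 2 ∣ p ^ e → p ≡ 2
  2∣p^e⇒p≡2 zero    2∣1 with ∣1⇒≡1 2∣1
  ... | ()
  2∣p^e⇒p≡2 (suc e) 2∣p^[1+e] with euclidsLemma p (p ^ e) prime[2] 2∣p^[1+e]
  ... | inj₂ 2∣p^e = 2∣p^e⇒p≡2 e 2∣p^e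
  ... | inj₁ 2∣p with prime⇒irreducible p-prime 2∣p
  ...   | inj₁ ()
  ...   | inj₂ 2≡p = sym 2≡p

  prime-power-∣-1-[-1]^ : ∀ e {q₀} → p ^ e ≡ suc q₀ → ℤ.+ p ∣ᶻ 1ℤ ℤ.- -1ℤ ℤ.^ q₀
  prime-power-∣-1-[-1]^ e {q₀} q≡1+q₀ with -1^-parity q₀
  ... | inj₁ (even , _)     rewrite even = ℤ.∣ᵤ⇒∣ (divides 0 refl)
  ... | inj₂ (odd , 2∣1+q₀)
    rewrite odd | 2∣p^e⇒p≡2 e (subst (2 ∣_) (sym q≡1+q₀) 2∣1+q₀) = ℤ.∣-refl

  p∣Δ^[p^e]𝟙 : ∀ e t → ℤ.+ p ∣ᶻ Δ^ (p ^ e) 𝟙[ p ^ e ∣_] t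
  p∣Δ^[p^e]𝟙 e t = subst (λ q → ℤ.+ p ∣ᶻ Δ^ q 𝟙[ q ∣_] t) q₀+1≡q
    (Δ^q-𝟙-∣ q₀ (prime-power-∣-C e (sym q₀+1≡q)) (prime-power-∣-1-[-1]^ e (sym q₀+1≡q)) t)
    where
      q₀ = pred (p ^ e)
      q₀+1≡q : suc q₀ ≡ p ^ e
      q₀+1≡q = suc-pred (p ^ e) {{m^n≢0 p e}}

-- Olson's theorem

D* : (p : ℕ) {d : ℕ} → (Fin d → ℕ) → ℕ
D* p e = suc (sum (tabulate (λ i → p ^ e i ∸ 1)))

-- A sequence over any A is read in G = ⊕ᵢ C_{p^{e i}} through the coordinates w a i, so that
-- the same statements also apply to C_q ⊕ G.
ZeroSumMod : (p : ℕ) {d : ℕ} (e : Fin d → ℕ) {A : Set} → (A → Fin d → ℕ) → List A → Set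
ZeroSumMod p e w T = ∀ i → p ^ e i ∣ sum (map (λ a → w a i) T)

NonEmptyZeroSum : (p : ℕ) {d : ℕ} (e : Fin d → ℕ) {A : Set} → (A → Fin d → ℕ) → List A → Set
NonEmptyZeroSum p e w T = ¬ T ≡ [] × ZeroSumMod p e w T

module _ {d : ℕ} where

  count : Fin d → List (Fin d) → ℕ
  count i L = sum (map (λ j → if does (j ≟ i) then 1 else 0) L)

  count-++ : ∀ i xs ys → count i (xs ++ ys) ≡ count i xs + count i ys
  count-++ i xs ys = trans (cong sum (map-++ _ xs ys)) (sum-++ (map _ xs) _)

  count-here : ∀ i L → count i (i ∷ L) ≡ suc (count i L)
  count-here i L = cong (λ b → (if b then 1 else 0) + count i L) (dec-true (i ≟ i) refl)

  length≡sum-count : ∀ L → length L ≡ sum (tabulate (λ i → count i L))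
  length≡sum-count []      = sym (sum-tabulate-zero d)
  length≡sum-count (j ∷ L) = begin
    suc (length L)
      ≡⟨ cong₂ _+_ (sym (sum-tabulate-indicator j 1)) (length≡sum-count L) ⟩
    sum (tabulate (λ i → if does (j ≟ i) then 1 else 0)) + sum (tabulate (λ i → count i L))
      ≡⟨ sum-tabulate-+ (λ i → if does (j ≟ i) then 1 else 0) (λ i → count i L) ⟨
    sum (tabulate (λ i → count i (j ∷ L))) ∎
    where open ≡-Reasoning

  pigeonhole : ∀ p (e : Fin d → ℕ) L → D* p e ≤ length L → Σ (Fin d) λ i → p ^ e i ≤ count i L
  pigeonhole p e L D*≤L with any? (λ i → p ^ e i ≤? count i L)
  ... | yes found = found
  ... | no  none  = ⊥-elim (<⇒≱ (s≤s |L|≤) D*≤L)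
    where
      below : ∀ i → count i L ≤ p ^ e i ∸ 1
      below i = ∸-monoˡ-≤ 1 (≰⇒> (λ q≤count → none (i , q≤count)))
      |L|≤ : length L ≤ sum (tabulate (λ i → p ^ e i ∸ 1))
      |L|≤ = ≤-trans (≤-reflexive (length≡sum-count L)) (sum-tabulate-mono-≤ below)

path : ∀ {n} → (Fin n → ℕ) → List (Fin n)
path {zero}  v = []
path {suc n} v = replicate (v zero) zero ++ map suc (path (v ∘ suc))

count-path : ∀ {n} (v : Fin n → ℕ) i → count i (path v) ≡ v i
count-path {suc n} v zero    = begin
  count zero (replicate (v zero) zero ++ map suc (path (v ∘ suc)))
    ≡⟨ count-++ zero (replicate (v zero) zero) _ ⟩
  count zero (replicate (v zero) zero) + count zero (map suc (path (v ∘ suc)))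
    ≡⟨ cong₂ _+_ (count-replicate (v zero)) (count-zero-suc (path (v ∘ suc))) ⟩
  v zero + 0
    ≡⟨ +-identityʳ (v zero) ⟩
  v zero ∎
  where
    open ≡-Reasoning
    count-replicate : ∀ k → count zero (replicate k (zero {n})) ≡ k
    count-replicate zero    = refl
    count-replicate (suc k) = cong suc (count-replicate k)
    count-zero-suc : ∀ (L : List (Fin n)) → count zero (map suc L) ≡ 0
    count-zero-suc []      = refl
    count-zero-suc (_ ∷ L) = count-zero-suc L
count-path {suc n} v (suc i) = begin
  count (suc i) (replicate (v zero) zero ++ map suc (path (v ∘ suc)))
    ≡⟨ count-++ (suc i) (replicate (v zero) zero) _ ⟩
  count (suc i) (replicate (v zero) zero) + count (suc i) (map suc (path (v ∘ suc)))
    ≡⟨ cong₂ _+_ (count-replicate (v zero)) (count-suc-suc (path (v ∘ suc))) ⟩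
  count i (path (v ∘ suc))
    ≡⟨ count-path (v ∘ suc) i ⟩
  v (suc i) ∎
  where
    open ≡-Reasoning
    count-replicate : ∀ k → count (suc i) (replicate k zero) ≡ 0
    count-replicate zero    = refl
    count-replicate (suc k) = count-replicate k
    count-suc-suc : ∀ L → count (suc i) (map suc L) ≡ count i L
    count-suc-suc []      = refl
    count-suc-suc (j ∷ L) = cong ((if does (j ≟ i) then 1 else 0) +_) (count-suc-suc L)

module Olson {p : ℕ} (p-prime : Prime p) {d : ℕ} (e : Fin d → ℕ) where

  private
    q : Fin d → ℕ
    q i = p ^ e i

  Point : Set
  Point = Vec ℕ d

  step : Fin d → Point → Point
  step i x = updateAt x i suc

  walk : List (Fin d) → Point → Point
  walk []      x = x
  walk (i ∷ W) x = walk W (step i x)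

  step-comm : ∀ i j x → step i (step j x) ≡ step j (step i x)
  step-comm i j x with i ≟ j
  ... | yes refl = refl
  ... | no  i≢j  = updateAt-commutes i j i≢j x

  lookup-step : ∀ j x i → lookup (step j x) i ≡ (if does (j ≟ i) then 1 else 0) + lookup x i
  lookup-step j x i with j ≟ i
  ... | yes refl = lookup∘updateAt i x
  ... | no  j≢i  = lookup∘updateAt′ i j (j≢i ∘ sym) x

  walk-++ : ∀ V W x → walk (V ++ W) x ≡ walk W (walk V x)
  walk-++ []      W x = refl
  walk-++ (i ∷ V) W x = walk-++ V W (step i x)

  lookup-walk : ∀ W x i → lookup (walk W x) i ≡ lookup x i + count i W
  lookup-walk []      x i = sym (+-identityʳ (lookup x i))
  lookup-walk (j ∷ W) x i = begin
    lookup (walk W (step j x)) i                                ≡⟨ lookup-walk W (step j x) i ⟩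
    lookup (step j x) i + count i W                             ≡⟨ cong (_+ count i W) (lookup-step j x i) ⟩
    (if does (j ≟ i) then 1 else 0) + lookup x i + count i W    ≡⟨ +-assoc _ (lookup x i) (count i W) ⟩
    (if does (j ≟ i) then 1 else 0) + (lookup x i + count i W)  ≡⟨ x∙yz≈y∙xz _ (lookup x i) (count i W) ⟩
    lookup x i + count i (j ∷ W) ∎
    where open ≡-Reasoning

  ∂ : Fin d → (Point → ℤ) → Point → ℤ
  ∂ i f x = f x ℤ.- f (step i x)

  ∂* : List (Fin d) → (Point → ℤ) → Point → ℤ
  ∂* []      f = f
  ∂* (i ∷ L) f = ∂* L (∂ i f)

  ∂*-cong : ∀ L {f g : Point → ℤ} → (∀ x → f x ≡ g x) → ∀ x → ∂* L f x ≡ ∂* L g x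
  ∂*-cong []      f≗g = f≗g
  ∂*-cong (i ∷ L) f≗g = ∂*-cong L (λ y → cong₂ ℤ._-_ (f≗g y) (f≗g (step i y)))

  ∂*-+ : ∀ L (f g : Point → ℤ) x → ∂* L (λ y → f y ℤ.+ g y) x ≡ ∂* L f x ℤ.+ ∂* L g x
  ∂*-+ []      f g x = refl
  ∂*-+ (i ∷ L) f g x = trans (∂*-cong L (λ y → interchange-ℤ (f y) (g y) (f (step i y)) (g (step i y))) x)
                             (∂*-+ L (∂ i f) (∂ i g) x)
    where
      interchange-ℤ : ∀ a b c d → (a ℤ.+ b) ℤ.- (c ℤ.+ d) ≡ (a ℤ.- c) ℤ.+ (b ℤ.- d)
      interchange-ℤ = solve-∀

  ∂*-- : ∀ L (f g : Point → ℤ) x → ∂* L (λ y → f y ℤ.- g y) x ≡ ∂* L f x ℤ.- ∂* L g x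
  ∂*-- []      f g x = refl
  ∂*-- (i ∷ L) f g x = trans (∂*-cong L (λ y → interchange-ℤ (f y) (g y) (f (step i y)) (g (step i y))) x)
                             (∂*-- L (∂ i f) (∂ i g) x)
    where
      interchange-ℤ : ∀ a b c d → (a ℤ.- b) ℤ.- (c ℤ.- d) ≡ (a ℤ.- c) ℤ.- (b ℤ.- d)
      interchange-ℤ = solve-∀

  ∂*-step : ∀ L (f : Point → ℤ) j x → ∂* L (f ∘ step j) x ≡ ∂* L f (step j x)
  ∂*-step []      f j x = refl
  ∂*-step (i ∷ L) f j x = trans (∂*-cong L (λ y → cong (λ z → f (step j y) ℤ.- f z) (step-comm j i y)) x)
                                (∂*-step L (∂ i f) j x)

  ∂*-∂ : ∀ L (f : Point → ℤ) j x → ∂* L (∂ j f) x ≡ ∂ j (∂* L f) x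
  ∂*-∂ L f j x = trans (∂*-- L f (f ∘ step j) x) (cong (λ z → ∂* L f x ℤ.- z) (∂*-step L f j x))

  ∂*-∣ : ∀ L {f : Point → ℤ} → (∀ x → ℤ.+ p ∣ᶻ f x) → ∀ x → ℤ.+ p ∣ᶻ ∂* L f x
  ∂*-∣ []      p∣f = p∣f
  ∂*-∣ (i ∷ L) p∣f = ∂*-∣ L (λ y → ℤ.∣m∣n⇒∣m-n (p∣f y) (p∣f (step i y)))

  ∂*-separable : ∀ i c (ψ : ℕ → ℤ) (g h : Point → ℤ) → (∀ x → g (step i x) ≡ g x) →
                 (∀ x → h x ≡ ψ (lookup x i) ℤ.* g x) →
                 ∀ x → ∂* (replicate c i) h x ≡ Δ^ c ψ (lookup x i) ℤ.* g x
  ∂*-separable i zero    ψ g h g-inv h≡ψg = h≡ψg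
  ∂*-separable i (suc c) ψ g h g-inv h≡ψg = ∂*-separable i c (Δ ψ) g (∂ i h) g-inv ∂h≡Δψg
    where
      factor : ∀ a b c → a ℤ.* c ℤ.- b ℤ.* c ≡ (a ℤ.- b) ℤ.* c
      factor = solve-∀
      ∂h≡Δψg : ∀ y → ∂ i h y ≡ Δ ψ (lookup y i) ℤ.* g y
      ∂h≡Δψg y = begin
        h y ℤ.- h (step i y)
          ≡⟨ cong₂ ℤ._-_ (h≡ψg y) (h≡ψg (step i y)) ⟩
        ψ (lookup y i) ℤ.* g y ℤ.- ψ (lookup (step i y) i) ℤ.* g (step i y)
          ≡⟨ cong₂ (λ t z → ψ (lookup y i) ℤ.* g y ℤ.- ψ t ℤ.* z) (lookup∘updateAt i y) (g-inv y) ⟩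
        ψ (lookup y i) ℤ.* g y ℤ.- ψ (suc (lookup y i)) ℤ.* g y
          ≡⟨ factor (ψ (lookup y i)) _ (g y) ⟩
        Δ ψ (lookup y i) ℤ.* g y ∎
        where open ≡-Reasoning

  ∂*-∣-count : ∀ {i} c {f : Point → ℤ} → (∀ x → ℤ.+ p ∣ᶻ ∂* (replicate c i) f x) →
               ∀ L → c ≤ count i L → ∀ x → ℤ.+ p ∣ᶻ ∂* L f x
  ∂*-∣-count     zero    p∣∂ᶜf L _ = ∂*-∣ L p∣∂ᶜf
  ∂*-∣-count {i} (suc c) {f} p∣∂ᶜf (j ∷ L) c≤#i with j ≟ i
  ... | yes refl = ∂*-∣-count c p∣∂ᶜf L (≤-pred c≤#i)
  ... | no  j≢i  = ∂*-∣-count (suc c) p∣∂ᶜ∂f L c≤#i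
    where
      p∣∂ᶜ∂f : ∀ x → ℤ.+ p ∣ᶻ ∂* (replicate (suc c) i) (∂ j f) x
      p∣∂ᶜ∂f x = subst (ℤ.+ p ∣ᶻ_) (sym (∂*-∂ (replicate (suc c) i) f j x))
                       (ℤ.∣m∣n⇒∣m-n (p∣∂ᶜf x) (p∣∂ᶜf (step j x)))

  OnLattice : Point → Set
  OnLattice x = ∀ j → q j ∣ lookup x j

  origin : Point
  origin = Vec.replicate d 0

  origin∈ : OnLattice origin
  origin∈ j = subst (q j ∣_) (sym (lookup-replicate j 0)) (divides 0 refl)

  χ : Point → ℤ
  χ x = indicator (all? (λ j → q j ∣? lookup x j))

  clear : Fin d → Point → Point
  clear i x = updateAt x i (λ _ → 0)

  χ-split : ∀ i x → χ x ≡ 𝟙[ q i ∣ lookup x i ] ℤ.* χ (clear i x)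
  χ-split i x = split (q i ∣? lookup x i) (all? (λ j → q j ∣? lookup x j))
                      (all? (λ j → q j ∣? lookup (clear i x) j))
    where
      cleared : OnLattice x → OnLattice (clear i x)
      cleared x∈ j with j ≟ i
      ... | yes refl = subst (q j ∣_) (sym (lookup∘updateAt j x)) (divides 0 refl)
      ... | no  j≢i  = subst (q j ∣_) (sym (lookup∘updateAt′ j i j≢i x)) (x∈ j)

      uncleared : q i ∣ lookup x i → OnLattice (clear i x) → OnLattice x
      uncleared qᵢ∣xᵢ x′∈ j with j ≟ i
      ... | yes refl = qᵢ∣xᵢ
      ... | no  j≢i  = subst (q j ∣_) (lookup∘updateAt′ j i j≢i x) (x′∈ j)

      split : (a? : Dec (q i ∣ lookup x i)) (b? : Dec (OnLattice x)) (c? : Dec (OnLattice (clear i x))) →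
              indicator b? ≡ indicator a? ℤ.* indicator c?
      split (no ¬a) b?      _       = indicator-no b? (λ b → ¬a (b i))
      split (yes _) (yes _) (yes _) = refl
      split (yes _) (no _)  (no _)  = refl
      split (yes _) (yes b) (no ¬c) = ⊥-elim (¬c (cleared b))
      split (yes a) (no ¬b) (yes c) = ⊥-elim (¬b (uncleared a c))

  χ-∂-coordinate : ∀ i x → ℤ.+ p ∣ᶻ ∂* (replicate (q i) i) χ x
  χ-∂-coordinate i x =
    subst (ℤ.+ p ∣ᶻ_) (sym separated) (ℤ.∣m⇒∣m*n (χ (clear i x)) (p∣Δ^[p^e]𝟙 p-prime (e i) (lookup x i)))
    where
      separated : ∂* (replicate (q i) i) χ x ≡ Δ^ (q i) 𝟙[ q i ∣_] (lookup x i) ℤ.* χ (clear i x)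
      separated = ∂*-separable i (q i) 𝟙[ q i ∣_] (χ ∘ clear i) χ (λ y → cong χ (updateAt-updateAt i y))
                               (χ-split i) x

  -- f behaves like a polynomial of degree < D* − m over 𝔽ₚ.
  DifferencesVanish : ℕ → (Point → ℤ) → Set
  DifferencesVanish m f = ∀ L → D* p e ≤ m + length L → ∀ x → ℤ.+ p ∣ᶻ ∂* L f x

  χ-differences-vanish : DifferencesVanish 0 χ
  χ-differences-vanish L D*≤L with pigeonhole p e L D*≤L
  ... | i , qᵢ≤#i = ∂*-∣-count (q i) (χ-∂-coordinate i) L qᵢ≤#i

  differences-vanish-walk : ∀ {m f} → DifferencesVanish m f →
                            ∀ W → DifferencesVanish (suc m) (λ x → f x ℤ.- f (walk W x))
  differences-vanish-walk {f = f} vanish []      L _ x =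
    ∂*-∣ L (λ y → subst (ℤ.+ p ∣ᶻ_) (sym (ℤ.+-inverseʳ (f y))) (ℤ.∣ᵤ⇒∣ (divides 0 refl))) x
  differences-vanish-walk {m} {f} vanish (i ∷ W) L D*≤ x =
    subst (ℤ.+ p ∣ᶻ_) (sym telescoped) (ℤ.∣m∣n⇒∣m+n (vanish (i ∷ L) D*≤′ x)
                                                  (differences-vanish-walk vanish W L D*≤ (step i x)))
    where
      D*≤′ : D* p e ≤ m + length (i ∷ L)
      D*≤′ = subst (D* p e ≤_) (sym (+-suc m (length L))) D*≤
      g : Point → ℤ
      g y = f y ℤ.- f (walk W y)
      telescope : ∀ a b c → a ℤ.- c ≡ (a ℤ.- b) ℤ.+ (b ℤ.- c)
      telescope = solve-∀
      telescoped : ∂* L (λ y → f y ℤ.- f (walk W (step i y))) x ≡ ∂* L (∂ i f) x ℤ.+ ∂* L g (step i x)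
      telescoped = begin
        ∂* L (λ y → f y ℤ.- f (walk W (step i y))) x
          ≡⟨ ∂*-cong L (λ y → telescope (f y) (f (step i y)) (f (walk W (step i y)))) x ⟩
        ∂* L (λ y → ∂ i f y ℤ.+ g (step i y)) x
          ≡⟨ ∂*-+ L (∂ i f) (g ∘ step i) x ⟩
        ∂* L (∂ i f) x ℤ.+ ∂* L (g ∘ step i) x
          ≡⟨ cong (λ z → ∂* L (∂ i f) x ℤ.+ z) (∂*-step L g i x) ⟩
        ∂* L (∂ i f) x ℤ.+ ∂* L g (step i x) ∎
        where open ≡-Reasoning

  module _ {A : Set} (w : A → Fin d → ℕ) where

    paths : List A → List (Fin d)
    paths []      = []
    paths (a ∷ T) = path (w a) ++ paths T

    count-paths : ∀ i T → count i (paths T) ≡ sum (map (λ a → w a i) T)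
    count-paths i []      = refl
    count-paths i (a ∷ T) = trans (count-++ i (path (w a)) (paths T))
                                  (cong₂ _+_ (count-path (w a) i) (count-paths i T))

    -- Φ S x = Σ_{T ⊆ S} (−1)^|T| χ (x + Σ_{a ∈ T} w a).
    Φ : List A → Point → ℤ
    Φ []      = χ
    Φ (a ∷ S) x = Φ S x ℤ.- Φ S (walk (path (w a)) x)

    Φ-differences-vanish : ∀ S → DifferencesVanish (length S) (Φ S)
    Φ-differences-vanish []      = χ-differences-vanish
    Φ-differences-vanish (a ∷ S) = differences-vanish-walk (Φ-differences-vanish S) (path (w a))

    Reaches : Point → List A → Set
    Reaches x T = OnLattice (walk (paths T) x)

    Reaches-∷ : ∀ {x} a T → Reaches (walk (path (w a)) x) T → Reaches x (a ∷ T)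
    Reaches-∷ {x} a T = subst OnLattice (sym (walk-++ (path (w a)) (paths T) x))

    Φ-off-lattice : ∀ S x → Φ S x ≡ 0ℤ ⊎ Selects (Reaches x) S
    Φ-off-lattice []      x with all? (λ j → q j ∣? lookup x j)
    ... | yes x∈ = inj₂ ((λ ()) , x∈)
    ... | no  x∉ = inj₁ (indicator-no (all? (λ j → q j ∣? lookup x j)) x∉)
    Φ-off-lattice (a ∷ S) x with Φ-off-lattice S x | Φ-off-lattice S (walk (path (w a)) x)
    ... | inj₂ (b , reach) | _                = inj₂ (false ∷ᶠ b , reach)
    ... | inj₁ _           | inj₂ (b , reach) = inj₂ (true ∷ᶠ b , Reaches-∷ a (select S b) reach)
    ... | inj₁ Φ≡0         | inj₁ Φ′≡0        = inj₁ (cong₂ ℤ._-_ Φ≡0 Φ′≡0)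

    Φ-on-lattice : ∀ S x → OnLattice x → Φ S x ≡ 1ℤ ⊎ Selects (λ T → ¬ T ≡ [] × Reaches x T) S
    Φ-on-lattice []      x x∈ = inj₁ (indicator-yes (all? (λ j → q j ∣? lookup x j)) x∈)
    Φ-on-lattice (a ∷ S) x x∈ with Φ-on-lattice S x x∈
    ... | inj₂ (b , T≢[] , reach) = inj₂ (false ∷ᶠ b , T≢[] , reach)
    ... | inj₁ Φ≡1 with Φ-off-lattice S (walk (path (w a)) x)
    ...   | inj₁ Φ′≡0        = inj₁ (cong₂ ℤ._-_ Φ≡1 Φ′≡0)
    ...   | inj₂ (b , reach) = inj₂ (true ∷ᶠ b , (λ ()) , Reaches-∷ a (select S b) reach)

    olson : ∀ S → D* p e ≤ length S → Selects (NonEmptyZeroSum p e w) S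
    olson S D*≤S with Φ-on-lattice S origin origin∈
    ... | inj₁ Φ≡1 =
      ⊥-elim (nonTrivial⇒≢1 {{prime⇒nonTrivial p-prime}} (∣1⇒≡1 (ℤ.∣⇒∣ᵤ p∣1)))
      where
        p∣1 : ℤ.+ p ∣ᶻ 1ℤ
        p∣1 = subst (ℤ.+ p ∣ᶻ_) Φ≡1
                    (Φ-differences-vanish S [] (subst (D* p e ≤_) (sym (+-identityʳ _)) D*≤S) origin)
    ... | inj₂ (b , T≢[] , reach) = b , T≢[] , λ i → subst (q i ∣_) (reach≡ i) (reach i)
      where
        reach≡ : ∀ i → lookup (walk (paths (select S b)) origin) i ≡ sum (map (λ a → w a i) (select S b))
        reach≡ i = trans (lookup-walk (paths (select S b)) origin i)
                         (cong₂ _+_ (lookup-replicate i 0) (count-paths i (select S b)))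

-- The upper bound

zero-sum-complement : ∀ p {d} (e : Fin d → ℕ) {A : Set} (w : A → Fin d → ℕ) T b →
                      ZeroSumMod p e w T → ZeroSumMod p e w (select T b) → ZeroSumMod p e w (select T (not ∘ b))
zero-sum-complement p e w T b zsT zsU i =
  ∣m+n∣m⇒∣n (subst (p ^ e i ∣_) (sum-select-split (λ a → w a i) T b) (zsT i)) (zsU i)

module _ {p : ℕ} (p-prime : Prime p) where

  olson-short : ∀ {d} (e : Fin d → ℕ) {A : Set} (w : A → Fin d → ℕ) S → D* p e ≤ length S →
                Selects (λ T → NonEmptyZeroSum p e w T × length T ≤ D* p e) S
  olson-short e w S D*≤S = Selects-take {P = λ T → NonEmptyZeroSum p e w T × length T ≤ D* p e} (D* p e) S
                             (bounded (Olson.olson p-prime e w prefix (≤-reflexive (sym |prefix|≡D*))))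
    where
      prefix = take (D* p e) S
      |prefix|≡D* : length prefix ≡ D* p e
      |prefix|≡D* = trans (length-take (D* p e) S) (m≤n⇒m⊓n≡m D*≤S)
      bounded : Selects (NonEmptyZeroSum p e w) prefix →
                Selects (λ T → NonEmptyZeroSum p e w T × length T ≤ D* p e) prefix
      bounded (c , nezs) = c , nezs , ≤-trans (length-select-≤ prefix c) (≤-reflexive |prefix|≡D*)

  module _ {d : ℕ} (e : Fin d → ℕ) {A : Set} (w : A → Fin d → ℕ)
           (e★ : ℕ) (D*<2q : D* p e < p ^ e★ + p ^ e★) where

    private
      q : ℕ
      q = p ^ e★

    ShortZeroSum : List A → Set
    ShortZeroSum T = NonEmptyZeroSum p e w T × length T ≤ q

    halve : ∀ T → ZeroSumMod p e w T → length T ≡ q + q → Selects ShortZeroSum T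
    halve T zsT |T|≡2q with olson-short e w T (<⇒≤ (subst (D* p e <_) (sym |T|≡2q) D*<2q))
    ... | b , (U≢[] , zsU) , |U|≤D* with length (select T b) ≤? q
    ...   | yes |U|≤q = b , (U≢[] , zsU) , |U|≤q
    ...   | no  |U|≰q = not ∘ b , (V≢[] , zero-sum-complement p e w T b zsT zsU) , |V|≤q
      where
        |U|+|V|≡2q : length (select T b) + length (select T (not ∘ b)) ≡ q + q
        |U|+|V|≡2q = trans (length-select-split T b) |T|≡2q
        V≢[] : ¬ select T (not ∘ b) ≡ []
        V≢[] V≡[] = <⇒≱ D*<2q (subst (_≤ D* p e) |U|≡2q |U|≤D*)
          where
            |U|≡2q : length (select T b) ≡ q + q
            |U|≡2q = trans (sym (+-identityʳ _))
                           (trans (cong (λ V → length (select T b) + length V) (sym V≡[])) |U|+|V|≡2q)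
        |V|≤q : length (select T (not ∘ b)) ≤ q
        |V|≤q = +-cancelˡ-≤ q _ _ (≤-trans (+-monoˡ-≤ _ (<⇒≤ (≰⇒> |U|≰q))) (≤-reflexive |U|+|V|≡2q))

    -- Read in C_q ⊕ G through a ↦ (1, w a), a zero-sum subsequence has length divisible by q;
    -- the one given by Olson there is shorter than 3q.
    short-zero-sum : ∀ S → D* p e + (q ∸ 1) ≤ length S → Selects ShortZeroSum S
    short-zero-sum S long with olson-short (e★ ∷ᶠ e) (λ a → 1 ∷ᶠ w a) S (subst (_≤ length S) D*+q∸1≡D*′ long)
      where
        D*+q∸1≡D*′ : D* p e + (q ∸ 1) ≡ D* p (e★ ∷ᶠ e)
        D*+q∸1≡D*′ = cong suc (+-comm _ (q ∸ 1))
    ... | b , (T≢[] , zs′) , |T|≤D*′ = by-multiple (subst (q ∣_) (sum-map-1 T) (zs′ zero))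
      where
        T = select S b
        zs : ZeroSumMod p e w T
        zs i = zs′ (suc i)
        by-multiple : q ∣ length T → Selects ShortZeroSum S
        by-multiple (divides zero |T|≡0) = ⊥-elim (T≢[] (length≡0⇒≡[] |T|≡0))
          where
            length≡0⇒≡[] : ∀ {xs : List A} → length xs ≡ 0 → xs ≡ []
            length≡0⇒≡[] {[]} _ = refl
        by-multiple (divides 1 |T|≡q+0) = b , (T≢[] , zs) , ≤-reflexive (trans |T|≡q+0 (+-identityʳ q))
        by-multiple (divides 2 |T|≡q+[q+0]) =
          Selects-join {P = ShortZeroSum} S (b , halve T zs (trans |T|≡q+[q+0] (cong (q +_) (+-identityʳ q))))
        by-multiple (divides (suc (suc (suc k))) |T|≡3q+) =
          ⊥-elim (<⇒≱ |T|<3q (subst (q + (q + q) ≤_) (sym |T|≡3q+) 3q≤))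
          where
            3q≤ : q + (q + q) ≤ q + (q + (q + k * q))
            3q≤ = +-monoʳ-≤ q (+-monoʳ-≤ q (m≤m+n q (k * q)))
            |T|<3q : length T < q + (q + q)
            |T|<3q = begin-strict
              length T           ≤⟨ |T|≤D*′ ⟩
              suc (q ∸ 1 + _)    ≡⟨ +-suc (q ∸ 1) _ ⟨
              q ∸ 1 + D* p e     <⟨ +-monoʳ-< (q ∸ 1) D*<2q ⟩
              q ∸ 1 + (q + q)    ≤⟨ +-monoˡ-≤ (q + q) (m∸n≤m q 1) ⟩
              q + (q + q) ∎
              where open ≤-Reasoning

    disjoint-zero-sums : ∀ r S → D* p e + r * q ≤ length S → HasDisjoint (NonEmptyZeroSum p e w) (suc r) S
    disjoint-zero-sums zero    S long with Olson.olson p-prime e w S (≤-trans (m≤m+n (D* p e) 0) long)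
    ... | b , nezs = HasDisjoint-suc {Q = NonEmptyZeroSum p e w} S b nezs
                                     (HasDisjoint-zero {Q = NonEmptyZeroSum p e w} (select S (not ∘ b)))
    disjoint-zero-sums (suc r) S long
      with short-zero-sum S (≤-trans (+-monoʳ-≤ (D* p e) (≤-trans (m∸n≤m q 1) (m≤m+n q (r * q)))) long)
    ... | b , nezs , |T|≤q =
      HasDisjoint-suc {Q = NonEmptyZeroSum p e w} S b nezs
                      (disjoint-zero-sums r (select S (not ∘ b)) rest-long)
      where
        rest-long : D* p e + r * q ≤ length (select S (not ∘ b))
        rest-long = +-cancelˡ-≤ q _ _ (begin
          q + (D* p e + r * q)                               ≡⟨ x∙yz≈y∙xz q (D* p e) (r * q) ⟩
          D* p e + (q + r * q)                               ≤⟨ long ⟩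
          length S                                           ≡⟨ length-select-split S b ⟨
          length (select S b) + length (select S (not ∘ b))  ≤⟨ +-monoˡ-≤ _ |T|≤q ⟩
          q + length (select S (not ∘ b)) ∎)
          where open ≤-Reasoning

-- The lower bound

copies-of-one : ∀ m n .{{_ : NonZero m}} → m ∣ n * (1 % m) → n ≡ 0 ⊎ m ≤ n
copies-of-one m             zero    _     = inj₁ refl
copies-of-one (suc zero)    (suc n) _     = inj₂ (s≤s z≤n)
copies-of-one (suc (suc m)) (suc n) m∣n*1 = inj₂ (∣⇒≤ (subst (2 + m ∣_) (*-identityʳ (suc n)) m∣n*1))

module LowerBound {p : ℕ} (p-prime : Prime p) {d : ℕ} (e : Fin d → ℕ) (c : Fin d) (r : ℕ) where

  private
    q : Fin d → ℕ
    q i = p ^ e i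

    instance
      q≢0 : ∀ {i} → NonZero (q i)
      q≢0 {i} = m^n≢0 p (e i) {{prime⇒nonZero p-prime}}

  -- 1 % q j is 0 when q j = 1: the unit vector has no nonzero entry in a trivial factor.
  weight : Fin d → Fin d → ℕ
  weight i j = if does (i ≟ j) then 1 % q j else 0

  weight<q : ∀ i j → weight i j < q j
  weight<q i j with does (i ≟ j)
  ... | true  = m%n<n 1 (q j)
  ... | false = >-nonZero⁻¹ (q j)

  unit : Fin d → Elem p d e
  unit i j = fromℕ< (weight<q i j)

  multiplicity : Fin d → ℕ
  multiplicity i = if does (i ≟ c) then r * q c ∸ 1 else q i ∸ 1

  indices : List (Fin d)
  indices = path multiplicity

  extremal : Seq p d e
  extremal = map unit indices

  length-extremal : length extremal ≡ sum (tabulate multiplicity)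
  length-extremal = trans (length-map unit indices)
                          (trans (length≡sum-count indices) (cong sum (tabulate-cong (count-path multiplicity))))

  coordinate-sum-unit : ∀ j T → sum (map (λ g → toℕ (g j)) (map unit T)) ≡ sum (map (λ i → weight i j) T)
  coordinate-sum-unit j []      = refl
  coordinate-sum-unit j (i ∷ T) = cong₂ _+_ (toℕ-fromℕ< (weight<q i j)) (coordinate-sum-unit j T)

  sum-weight : ∀ j T → sum (map (λ i → weight i j) T) ≡ count j T * (1 % q j)
  sum-weight j []      = refl
  sum-weight j (i ∷ T) with does (i ≟ j)
  ... | true  = cong (1 % q j +_) (sum-weight j T)
  ... | false = sum-weight j T

  count-zero-sum : ∀ T → ZeroSumMod p e weight T → ∀ j → count j T ≡ 0 ⊎ q j ≤ count j T
  count-zero-sum T zs j = copies-of-one (q j) (count j T) (subst (q j ∣_) (sum-weight j T) (zs j))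

  others-absent : ∀ T → (∀ j → count j T ≤ multiplicity j) → ZeroSumMod p e weight T →
                  ∀ j → j ≢ c → count j T ≡ 0
  others-absent T T⊆ zs j j≢c = [ id , (λ q≤#j → ⊥-elim (<⇒≱ #j<q q≤#j)) ]′ (count-zero-sum T zs j)
    where
      #j<q : count j T < q j
      #j<q = m≤pred[n]⇒suc[m]≤n (subst (count j T ≤_) multiplicity≡ (T⊆ j))
        where
          multiplicity≡ : multiplicity j ≡ q j ∸ 1
          multiplicity≡ = cong (if_then r * q c ∸ 1 else q j ∸ 1) (dec-false (j ≟ c) j≢c)

  block-count : ∀ T → (∀ j → count j T ≤ multiplicity j) → NonEmptyZeroSum p e weight T →
                q c ≤ count c T
  block-count []      _  (T≢[] , _)  = ⊥-elim (T≢[] refl)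
  block-count (i ∷ T) T⊆ (_    , zs) = [ ⊥-elim ∘ c-present , id ]′ (count-zero-sum (i ∷ T) zs c)
    where
      c-present : ¬ count c (i ∷ T) ≡ 0
      c-present with i ≟ c
      ... | yes refl = λ ()
      ... | no  i≢c  = λ _ → 1+n≢0 (trans (sym (count-here i T)) (others-absent (i ∷ T) T⊆ zs i i≢c))

  no-disjoint-zero-sums : 1 ≤ r → ¬ HasDisjointZS p d e r extremal
  no-disjoint-zero-sums 1≤r H with HasDisjoint-map unit {Q = λ T → ¬ T ≡ [] × IsZeroSum p d e T} indices H
  ... | ℓ , nezs = <⇒≱ (m≤pred[n]⇒suc[m]≤n ≤-refl) total
    where
      instance
        rq≢0 : NonZero (r * q c)
        rq≢0 = >-nonZero (*-mono-≤ 1≤r (>-nonZero⁻¹ (q c)))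
      block-nezs : ∀ k → NonEmptyZeroSum p e weight (block indices ℓ k)
      block-nezs k = (λ T≡[] → proj₁ (nezs k) (cong (map unit) T≡[])) ,
                     (λ j → subst (q j ∣_) (coordinate-sum-unit j (block indices ℓ k)) (proj₂ (nezs k) j))
      block-⊆ : ∀ k j → count j (block indices ℓ k) ≤ multiplicity j
      block-⊆ k j = ≤-trans (sum-select-≤ _ indices _) (≤-reflexive (count-path multiplicity j))
      total : r * q c ≤ r * q c ∸ 1
      total = begin
        r * q c
          ≡⟨ sum-tabulate-const r (q c) ⟨
        sum (tabulate {n = r} (λ _ → q c))
          ≤⟨ sum-tabulate-mono-≤ (λ k → block-count _ (block-⊆ k) (block-nezs k)) ⟩
        sum (tabulate (λ k → count c (block indices ℓ k)))
          ≤⟨ sum-blocks-≤ (λ i → if does (i ≟ c) then 1 else 0) indices ℓ ⟩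
        count c indices
          ≡⟨ count-path multiplicity c ⟩
        multiplicity c
          ≡⟨ cong (if_then r * q c ∸ 1 else q c ∸ 1) (dec-true (c ≟ c) refl) ⟩
        r * q c ∸ 1 ∎
        where open ≤-Reasoning

a+[s+n]∸[1+n]+1≡s+a : ∀ a s n → 1 ≤ a → a + (s + n) ∸ suc n + 1 ≡ s + a
a+[s+n]∸[1+n]+1≡s+a (suc a) s n _ = begin
  a + (s + n) ∸ n + 1   ≡⟨ cong (λ m → m ∸ n + 1) (+-assoc a s n) ⟨
  a + s + n ∸ n + 1     ≡⟨ cong (_+ 1) (m+n∸n≡m (a + s) n) ⟩
  a + s + 1             ≡⟨ +-comm (a + s) 1 ⟩
  suc (a + s)           ≡⟨ cong suc (+-comm a s) ⟩
  suc (s + a)           ≡⟨ +-suc s a ⟨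
  s + suc a ∎
  where open ≡-Reasoning

module _ {p : ℕ} (p-prime : Prime p) {n : ℕ} (e : Fin (suc n) → ℕ) where

  private
    instance
      p≢0 : NonZero p
      p≢0 = prime⇒nonZero p-prime

    q : ℕ
    q = p ^ e (fromℕ n)

    s : ℕ
    s = sum (tabulate (λ (i : Fin n) → p ^ e (inject₁ i) ∸ 1))

    open LowerBound p-prime e (fromℕ n) using (extremal; multiplicity; length-extremal; no-disjoint-zero-sums)

  1≤r*q : ∀ {r} → 1 ≤ r → 1 ≤ r * q
  1≤r*q 1≤r = *-mono-≤ 1≤r (m^n>0 p (e (fromℕ n)))

  D*≡s+q : D* p e ≡ s + q
  D*≡s+q = begin
    suc (sum (tabulate (λ i → p ^ e i ∸ 1)))  ≡⟨ cong suc (sum-tabulate-init-last (λ i → p ^ e i ∸ 1)) ⟩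
    suc (s + pred q)                          ≡⟨ +-suc s (pred q) ⟨
    s + suc (pred q)                          ≡⟨ cong (s +_) (suc-pred q {{m^n≢0 p (e (fromℕ n))}}) ⟩
    s + q ∎
    where open ≡-Reasoning

  davenport-value : ∀ r → 1 ≤ r →
                    r * q + sum (tabulate (λ (i : Fin n) → p ^ e (inject₁ i))) ∸ suc n + 1 ≡ s + r * q
  davenport-value r 1≤r =
    trans (cong (λ t → r * q + t ∸ suc n + 1) (sum-tabulate-∸1 _ (m^n>0 p ∘ e ∘ inject₁)))
          (a+[s+n]∸[1+n]+1≡s+a (r * q) s n (1≤r*q 1≤r))

  length-extremal-last : ∀ r → length (extremal r) ≡ s + (r * q ∸ 1)
  length-extremal-last r =
    trans (length-extremal r)
          (trans (sum-tabulate-init-last (multiplicity r)) (cong₂ _+_ (cong sum (tabulate-cong others)) last))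
    where
      others : ∀ i → multiplicity r (inject₁ i) ≡ p ^ e (inject₁ i) ∸ 1
      others i = cong (if_then r * q ∸ 1 else p ^ e (inject₁ i) ∸ 1)
                      (dec-false (inject₁ i ≟ fromℕ n) (fromℕ≢inject₁ ∘ sym))
      last : multiplicity r (fromℕ n) ≡ r * q ∸ 1
      last = cong (if_then r * q ∸ 1 else q ∸ 1) (dec-true (fromℕ n ≟ fromℕ n) refl)

  upper-bound : 1 + s ≤ q → ∀ r → 1 ≤ r → DavenportProp p (suc n) e r (s + r * q)
  upper-bound 1+s≤q (suc r) _ S long =
    disjoint-zero-sums p-prime e (λ g i → toℕ (g i)) (e (fromℕ n)) D*<2q r S
                       (subst (_≤ length S) s+[1+r]q≡D*+rq long)
    where
      D*<2q : D* p e < q + q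
      D*<2q = subst (_< q + q) (sym D*≡s+q) (+-monoˡ-< q 1+s≤q)
      s+[1+r]q≡D*+rq : s + suc r * q ≡ D* p e + r * q
      s+[1+r]q≡D*+rq = trans (sym (+-assoc s q (r * q))) (cong (_+ r * q) (sym D*≡s+q))

  lower-bound : ∀ r → 1 ≤ r → ∀ j → j < s + r * q → ¬ DavenportProp p (suc n) e r j
  lower-bound r 1≤r j j<s+rq davenport = no-disjoint-zero-sums r 1≤r (davenport (extremal r) j≤|extremal|)
    where
      j≤|extremal| : j ≤ length (extremal r)
      j≤|extremal| = subst (j ≤_) (trans (+-∸-assoc s (1≤r*q 1≤r)) (sym (length-extremal-last r)))
                           (suc[m]≤n⇒m≤pred[n] j<s+rq)

theorem3 : (p n : ℕ) → Prime p → (e : Fin (suc n) → ℕ)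
    → ((i : Fin n) → e (inject₁ i) ≤ e (fsuc i))
    → 1 + sum (tabulate (λ (i : Fin n) → p ^ e (inject₁ i) ∸ 1)) ≤ p ^ e (fromℕ n)
    → (r : ℕ) → 1 ≤ r
    → IsDavenport p (suc n) e r
        (r * p ^ e (fromℕ n) + sum (tabulate (λ (i : Fin n) → p ^ e (inject₁ i))) ∸ suc n + 1)
theorem3 p n p-prime e _ 1+s≤q r 1≤r rewrite davenport-value p-prime e r 1≤r =
    ≤-trans (1≤r*q p-prime e 1≤r) (m≤n+m _ _)
  , upper-bound p-prime e 1+s≤q r 1≤r
  , λ j _ → lower-bound p-prime e r 1≤r j
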